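{- Let $P$ be a finite bounded poset with an interpolating EL-labelling. Then the unique increasing chain from $\hat{0}$ to $\hat{1}$ is a left modular maximal chain of $P$.
   Context: A poset is bounded if it has a unique minimum $\hat 0$ and a unique maximum $\hat 1$. An edge-labelling of $P$ is a map $\gamma$ from the covering relations $y\lessdot z$ of $P$ to $\mathbb{Z}$. It is an EL-labelling if for every $y<z$: (i) there is a unique unrefinable chain $y=w_0\lessdot\cdots\lessdot w_r=z$ with weakly increasing labels (the increasing chain from $y$ to $z$), and (ii) its label sequence lexicographically precedes that of every other unrefinable chain from $y$ to $z$. It is interpolating if for every $y\lessdot u\lessdot z$, either $\gamma(y,u)<\gamma(u,z)$, or the increasing chain $y=w_0\lessdot\cdots\lessdot w_r=z$ has strictly increasing labels with $\gamma(w_0,w_1)=\gamma(u,z)$ and $\gamma(w_{r-1},w_r)=\gamma(y,u)$. $x\vee y$, $x\wedge y$ denote least common upper bound / greatest common lower bound when they exist. For $w,z\ge y$, $w\wedge_y z$ is the greatest element of $\{u: y\le u\le w,\ u\le z\}$ if it exists; for $w,y\le z$, $w\vee^z y$ is the least element of $\{u: w\le u,\ y\le u,\ u\le z\}$ if it exists. An element $x$ is viable if for all $y\le z$ both $(x\vee y)\wedge_y z$ and $(x\wedge z)\vee^z y$ exist; a viable $x$ is left modular if $(x\vee y)\wedge_y z=(x\wedge z)\vee^z y$ for all $y\le z$. A maximal chain is left modular if each of its elements is viable and left modular. -}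

module Defs where

open import Level using (0ℓ)
open import Data.Nat using (ℕ)
open import Data.Fin using (Fin)
open import Data.Integer as ℤ using (ℤ)
open import Data.List using (List; []; _∷_; _∷ʳ_)
open import Data.List.Relation.Unary.All using (All)
open import Data.List.Relation.Unary.Linked using (Linked)
open import Data.List.Relation.Binary.Lex.Strict using (Lex-<)
open import Data.List.Membership.Propositional using (_∈_)
open import Data.Product using (Σ; _×_; ∃; ∃-syntax)
open import Data.Sum using (_⊎_)
open import Relation.Nullary using (¬_)
open import Relation.Binary using (Rel; IsPartialOrder)
open import Relation.Binary.PropositionalEquality using (_≡_; _≢_)

module Poset {n : ℕ} (_≤_ : Rel (Fin n) 0ℓ) where

  _<_ : Rel (Fin n) 0ℓ
  x < y = x ≤ y × x ≢ y

  _⋖_ : Rel (Fin n) 0ℓ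
  y ⋖ z = y < z × (∀ w → ¬ (y < w × w < z))

  IsBounded : Fin n → Fin n → Set
  IsBounded bot top = ∀ x → bot ≤ x × x ≤ top

  -- An unrefinable chain y = w₀ ⋖ w₁ ⋖ ⋯ ⋖ w_r = z, represented by the
  -- list [w₁, …, w_r] of its elements after y.
  UChain : Fin n → Fin n → List (Fin n) → Set
  UChain y z []       = y ≡ z
  UChain y z (w ∷ ws) = y ⋖ w × UChain w z ws

  -- An edge labelling: its values are only used on covering pairs.
  EdgeLabelling : Set
  EdgeLabelling = Fin n → Fin n → ℤ

  labels : EdgeLabelling → Fin n → List (Fin n) → List ℤ
  labels γ y []       = []
  labels γ y (w ∷ ws) = γ y w ∷ labels γ w ws

  WeaklyIncr : List ℤ → Set
  WeaklyIncr = Linked ℤ._≤_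

  StrictlyIncr : List ℤ → Set
  StrictlyIncr = Linked ℤ._<_

  LexPrecedes : List ℤ → List ℤ → Set
  LexPrecedes = Lex-< _≡_ ℤ._<_

  IsEL : EdgeLabelling → Set
  IsEL γ = ∀ y z → y < z → Σ (List (Fin n)) λ ws →
      UChain y z ws × WeaklyIncr (labels γ y ws)
    × (∀ vs → UChain y z vs → WeaklyIncr (labels γ y vs) → vs ≡ ws)
    × (∀ vs → UChain y z vs → vs ≢ ws → LexPrecedes (labels γ y ws) (labels γ y vs))

  IsInterpolating : EdgeLabelling → Set
  IsInterpolating γ = ∀ y u z → y ⋖ u → u ⋖ z →
      (γ y u ℤ.< γ u z)
    ⊎ (Σ (List (Fin n)) λ ws → UChain y z ws × StrictlyIncr (labels γ y ws)
        × (∃[ l ] labels γ y ws ≡ γ u z ∷ l)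
        × (∃[ l ] labels γ y ws ≡ l ∷ʳ γ y u))

  IsJoin : Fin n → Fin n → Fin n → Set
  IsJoin x y j = x ≤ j × y ≤ j × (∀ u → x ≤ u → y ≤ u → j ≤ u)

  IsMeet : Fin n → Fin n → Fin n → Set
  IsMeet x y m = m ≤ x × m ≤ y × (∀ u → u ≤ x → u ≤ y → u ≤ m)

  -- m = w ∧_y z : greatest element of {u : y ≤ u ≤ w, u ≤ z}
  IsRelMeet : Fin n → Fin n → Fin n → Fin n → Set
  IsRelMeet y w z m = (y ≤ m × m ≤ w × m ≤ z)
                    × (∀ u → y ≤ u → u ≤ w → u ≤ z → u ≤ m)

  -- k = w ∨^z y : least element of {u : w ≤ u, y ≤ u, u ≤ z}
  IsRelJoin : Fin n → Fin n → Fin n → Fin n → Set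
  IsRelJoin z w y k = (w ≤ k × y ≤ k × k ≤ z)
                    × (∀ u → w ≤ u → y ≤ u → u ≤ z → k ≤ u)

  Viable : Fin n → Set
  Viable x = ∀ y z → y ≤ z →
      (Σ (Fin n) λ j → IsJoin x y j × ∃[ m ] IsRelMeet y j z m)
    × (Σ (Fin n) λ mt → IsMeet x z mt × ∃[ k ] IsRelJoin z mt y k)

  LeftModular : Fin n → Set
  LeftModular x = Viable x ×
    (∀ y z j m mt k → y ≤ z → IsJoin x y j → IsRelMeet y j z m
       → IsMeet x z mt → IsRelJoin z mt y k → m ≡ k)

  Comparable : Fin n → Fin n → Set
  Comparable x y = x ≤ y ⊎ y ≤ x

  IsMaximalChain : List (Fin n) → Set
  IsMaximalChain S = (∀ x y → x ∈ S → y ∈ S → Comparable x y)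
                   × (∀ x → (∀ s → s ∈ S → Comparable x s) → x ∈ S)

  IsLeftModularMaximalChain : List (Fin n) → Set
  IsLeftModularMaximalChain S = IsMaximalChain S × All LeftModular S

-- For a convex set P of labels, either every maximal chain of an interval [y, w] has all its
-- labels in P or none has (Labelled-agree): interpolation replaces a descent by a strictly
-- increasing chain whose labels run from the smaller to the larger label of the descent, and
-- repeating this sorts any chain into the increasing one. Applied to the half-lines (-∞, t] and
-- (t, ∞), it shows that every interval [y, z] has a unique split point, where the labels of
-- its increasing chain pass the threshold t, and that split points behave monotonically
-- (split-≤, split-≥). Interpolation also makes the labels of the increasing chain from 0̂ to 1̂
-- strictly increasing, so each of its elements x is the split point of [0̂, 1̂] for the label t
-- of the edge entering it (for 0̂, any t below all labels). Then x ∨ y is the split point of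
-- [y, 1̂], x ∧ z that of [0̂, z], and both (x ∨ y) ∧_y z and (x ∧ z) ∨^z y are the split point
-- of [y, z].
{-# OPTIONS --safe #-}
module Submission where

open import Defs
open import Level using (0ℓ)
open import Data.Nat using (ℕ)
open import Data.Fin using (Fin; _≟_)
open import Data.Fin.Induction using (spo-wellFounded; po-noetherian)
open import Data.Integer as ℤ using (ℤ)
import Data.Integer.Properties as ℤₚ
open import Data.List using (List; []; _∷_; _++_; _∷ʳ_)
open import Data.List.Properties using (∷-injectiveˡ; ∷-injectiveʳ)
open import Data.List.Relation.Unary.All as All using (All; []; _∷_)
open import Data.List.Relation.Unary.All.Properties using (++⁺; ++⁻; ∷ʳ⁻)
import Data.List.Relation.Unary.AllPairs.Properties as AllPairs
open import Data.List.Relation.Unary.Any using (here; there)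
open import Data.List.Relation.Unary.Linked as Linked using (Linked; []; [-]; _∷_)
open import Data.List.Relation.Unary.Linked.Properties
  using (Linked⇒All; Linked⇒AllPairs; AllPairs⇒Linked)
open import Data.List.Membership.Propositional using (_∈_)
open import Data.Product using (Σ-syntax; _×_; _,_; proj₁; proj₂; ∃; ∃-syntax)
open import Data.Sum using (inj₁; inj₂)
open import Data.Empty using (⊥-elim)
open import Function using (flip; _on_; _∘_)
open import Function.Bundles using (_⇔_; mk⇔; Equivalence)
open import Function.Construct.Identity using (⇔-id)
open import Function.Properties.Equivalence using (⇔-setoid)
open import Induction.WellFounded using (Acc; acc; WellFounded)
open import Relation.Nullary using (yes; no; contradiction)
open import Relation.Unary using (Pred; _⊆_)
open import Relation.Binary using (Rel; IsPartialOrder)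
import Relation.Binary.Construct.On as On
open import Relation.Binary.PropositionalEquality using (_≡_; _≢_; refl; sym; trans; subst; cong)
import Relation.Binary.Reasoning.Setoid as SetoidReasoning

Convex : Pred ℤ 0ℓ → Set
Convex P = ∀ {a b c} → P a → P b → a ℤ.≤ c → c ℤ.≤ b → P c

≤-convex : ∀ t → Convex (ℤ._≤ t)
≤-convex t _ b≤t _ c≤b = ℤₚ.≤-trans c≤b b≤t

<-convex : ∀ t → Convex (t ℤ.<_)
<-convex t t<a _ a≤c _ = ℤₚ.<-≤-trans t<a a≤c

Linked⇒All-≤-last : ∀ xs {b} → Linked ℤ._≤_ (xs ∷ʳ b) → All (ℤ._≤ b) (xs ∷ʳ b)
Linked⇒All-≤-last []           _              = ℤₚ.≤-refl ∷ []
Linked⇒All-≤-last (x ∷ [])     (x≤b ∷ _)      = x≤b ∷ ℤₚ.≤-refl ∷ []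
Linked⇒All-≤-last (x ∷ y ∷ xs) (x≤y ∷ sorted) with Linked⇒All-≤-last (y ∷ xs) sorted
... | y≤b ∷ rest = ℤₚ.≤-trans x≤y y≤b ∷ y≤b ∷ rest

All-sorted⇔ends : ∀ {P} → Convex P → ∀ {xs a b} → Linked ℤ._≤_ xs →
  (∃[ l ] xs ≡ a ∷ l) → (∃[ l ] xs ≡ l ∷ʳ b) → All P xs ⇔ (P a × P b)
All-sorted⇔ends {P} convex {a = a} {b} sorted (l , refl) (l′ , xs≡l′∷ʳb) = mk⇔ ends between
  where
  ends : All P (a ∷ l) → P a × P b
  ends pxs = All.head pxs , proj₂ (∷ʳ⁻ (subst (All P) xs≡l′∷ʳb pxs))

  ≤b : All (ℤ._≤ b) (a ∷ l)
  ≤b = subst (All (ℤ._≤ b)) (sym xs≡l′∷ʳb)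
         (Linked⇒All-≤-last l′ (subst (Linked ℤ._≤_) xs≡l′∷ʳb sorted))

  between : P a × P b → All P (a ∷ l)
  between (pa , pb) = All.zipWith (λ (a≤c , c≤b) → convex pa pb a≤c c≤b)
                                  (Linked⇒All ℤₚ.≤-trans ℤₚ.≤-refl sorted , ≤b)

++-sorted : ∀ t {xs ys} → Linked ℤ._≤_ xs → Linked ℤ._≤_ ys →
  All (ℤ._≤ t) xs → All (t ℤ.<_) ys → Linked ℤ._≤_ (xs ++ ys)
++-sorted t sorted-xs sorted-ys xs≤t t<ys = AllPairs⇒Linked
  (AllPairs.++⁺ (Linked⇒AllPairs ℤₚ.≤-trans sorted-xs) (Linked⇒AllPairs ℤₚ.≤-trans sorted-ys)
                (All.map (λ x≤t → All.map (ℤₚ.≤-trans x≤t ∘ ℤₚ.<⇒≤) t<ys) xs≤t))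

strict-lowerBound : ∀ {xs} → Linked ℤ._<_ xs → ∃[ t ] Linked ℤ._<_ (t ∷ xs)
strict-lowerBound {[]}    _      = ℤ.0ℤ , [-]
strict-lowerBound {x ∷ _} sorted = ℤ.pred x , ℤₚ.i≤pred[j]⇒i<j ℤₚ.≤-refl ∷ sorted

module UnrefinableChains {n} {_≤_ : Rel (Fin n) 0ℓ} (po : IsPartialOrder _≡_ _≤_) where
  open Poset _≤_
  open IsPartialOrder po using (antisym) renaming (refl to ≤-refl; trans to ≤-trans)

  ⋖⇒≤ : ∀ {y z} → y ⋖ z → y ≤ z
  ⋖⇒≤ = proj₁ ∘ proj₁

  UChain⇒≤ : ∀ {y z} ws → UChain y z ws → y ≤ z
  UChain⇒≤ []       refl          = ≤-refl
  UChain⇒≤ (w ∷ ws) (y⋖w , w⇝z) = ≤-trans (⋖⇒≤ y⋖w) (UChain⇒≤ ws w⇝z)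

  UChain-++ : ∀ {x y z} us vs → UChain x y us → UChain y z vs → UChain x z (us ++ vs)
  UChain-++ []       vs refl          y⇝z = y⇝z
  UChain-++ (u ∷ us) vs (x⋖u , u⇝y) y⇝z = x⋖u , UChain-++ us vs u⇝y y⇝z

  UChain-loop : ∀ {y} ws → UChain y y ws → ws ≡ []
  UChain-loop []       _                            = refl
  UChain-loop (w ∷ ws) (((y≤w , y≢w) , _) , w⇝y) = ⊥-elim (y≢w (antisym y≤w (UChain⇒≤ ws w⇝y)))

  labels-++ : ∀ (γ : EdgeLabelling) {x y} us vs → UChain x y us →
    labels γ x (us ++ vs) ≡ labels γ x us ++ labels γ y vs
  labels-++ γ     []       vs refl      = refl
  labels-++ γ {x} (u ∷ us) vs (_ , u⇝y) = cong (γ x u ∷_) (labels-++ γ us vs u⇝y)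

  IsJoin-unique : ∀ {x y j j′} → IsJoin x y j → IsJoin x y j′ → j ≡ j′
  IsJoin-unique (x≤j , y≤j , least) (x≤j′ , y≤j′ , least′) =
    antisym (least _ x≤j′ y≤j′) (least′ _ x≤j y≤j)

  IsMeet-unique : ∀ {x y m m′} → IsMeet x y m → IsMeet x y m′ → m ≡ m′
  IsMeet-unique (m≤x , m≤y , greatest) (m′≤x , m′≤y , greatest′) =
    antisym (greatest′ _ m≤x m≤y) (greatest _ m′≤x m′≤y)

  IsRelMeet-unique : ∀ {y w z m m′} → IsRelMeet y w z m → IsRelMeet y w z m′ → m ≡ m′
  IsRelMeet-unique ((y≤m , m≤w , m≤z) , greatest) ((y≤m′ , m′≤w , m′≤z) , greatest′) =
    antisym (greatest′ _ y≤m m≤w m≤z) (greatest _ y≤m′ m′≤w m′≤z)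

  IsRelJoin-unique : ∀ {z w y k k′} → IsRelJoin z w y k → IsRelJoin z w y k′ → k ≡ k′
  IsRelJoin-unique ((w≤k , y≤k , k≤z) , least) ((w≤k′ , y≤k′ , k′≤z) , least′) =
    antisym (least _ w≤k′ y≤k′ k′≤z) (least′ _ w≤k y≤k k≤z)

  UChain-∈⇒≥ : ∀ {y z x} ws → UChain y z ws → x ∈ y ∷ ws → y ≤ x
  UChain-∈⇒≥ _        _           (here refl) = ≤-refl
  UChain-∈⇒≥ (w ∷ ws) (y⋖w , w⇝z) (there x∈) = ≤-trans (⋖⇒≤ y⋖w) (UChain-∈⇒≥ ws w⇝z x∈)

  UChain-comparable : ∀ {y z} ws → UChain y z ws →
    ∀ a b → a ∈ y ∷ ws → b ∈ y ∷ ws → Comparable a b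
  UChain-comparable ws ch _ _ (here refl) b∈ = inj₁ (UChain-∈⇒≥ ws ch b∈)
  UChain-comparable ws ch _ _ (there a∈) (here refl) = inj₂ (UChain-∈⇒≥ ws ch (there a∈))
  UChain-comparable (w ∷ ws) (_ , w⇝z) a b (there a∈) (there b∈) =
    UChain-comparable ws w⇝z a b a∈ b∈

  UChain-saturated : ∀ {y z x} ws → UChain y z ws → y ≤ x → x ≤ z →
    (∀ s → s ∈ ws → Comparable x s) → x ∈ y ∷ ws
  UChain-saturated [] refl y≤x x≤y _ = here (antisym x≤y y≤x)
  UChain-saturated {y} {x = x} (w ∷ ws) (y⋖w , w⇝z) y≤x x≤z comparable
    with comparable w (here refl)
  ... | inj₂ w≤x = there (UChain-saturated ws w⇝z w≤x x≤z (λ s s∈ → comparable s (there s∈)))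
  ... | inj₁ x≤w with x ≟ y | x ≟ w
  ...   | yes x≡y | _       = here x≡y
  ...   | no _    | yes x≡w = there (here x≡w)
  ...   | no x≢y  | no x≢w  = ⊥-elim (proj₂ y⋖w x ((y≤x , x≢y ∘ sym) , (x≤w , x≢w)))

  UChain⇒maximal : ∀ {bot top} → IsBounded bot top →
    ∀ ws → UChain bot top ws → IsMaximalChain (bot ∷ ws)
  UChain⇒maximal bounded ws ch =
    UChain-comparable ws ch ,
    λ x comparable → UChain-saturated ws ch (proj₁ (bounded x)) (proj₂ (bounded x))
                                       (λ s s∈ → comparable s (there s∈))

module ELLabelling {n} {_≤_ : Rel (Fin n) 0ℓ} (po : IsPartialOrder _≡_ _≤_)
                   {γ : Poset.EdgeLabelling _≤_} (el : Poset.IsEL _≤_ γ) where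
  open Poset _≤_
  open UnrefinableChains po

  IncreasingChain : Fin n → Fin n → List (Fin n) → Set
  IncreasingChain y z ws = UChain y z ws × WeaklyIncr (labels γ y ws)

  increasingChain : ∀ {y z} → y ≤ z → ∃ (IncreasingChain y z)
  increasingChain {y} {z} y≤z with y ≟ z
  ... | yes refl = [] , refl , []
  ... | no y≢z   = let (ws , ch , incr , _) = el y z (y≤z , y≢z) in ws , ch , incr

  IncreasingChain-unique : ∀ {y z ws ws′} →
    IncreasingChain y z ws → IncreasingChain y z ws′ → ws ≡ ws′
  IncreasingChain-unique {y} {z} {ws} {ws′} (ch , incr) (ch′ , incr′) with y ≟ z
  ... | yes refl = trans (UChain-loop ws ch) (sym (UChain-loop ws′ ch′))
  ... | no y≢z   = let (_ , _ , _ , unique , _) = el y z (UChain⇒≤ ws ch , y≢z)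
                   in trans (unique ws ch incr) (sym (unique ws′ ch′ incr′))

  Labelled : Pred ℤ 0ℓ → Fin n → List (Fin n) → Set
  Labelled P y ws = All P (labels γ y ws)

  LabelledChain : Pred ℤ 0ℓ → Fin n → Fin n → Set
  LabelledChain P y z = ∃ λ ws → UChain y z ws × Labelled P y ws

  LabelledChain⇒≤ : ∀ {P y z} → LabelledChain P y z → y ≤ z
  LabelledChain⇒≤ (ws , ch , _) = UChain⇒≤ ws ch

  LabelledChain-trans : ∀ {P x y z} → LabelledChain P x y → LabelledChain P y z → LabelledChain P x z
  LabelledChain-trans {P} (us , x⇝y , pus) (vs , y⇝z , pvs) =
    us ++ vs , UChain-++ us vs x⇝y y⇝z , subst (All P) (sym (labels-++ γ us vs x⇝y)) (++⁺ pus pvs)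

  LabelledChain-map : ∀ {P Q y z} → P ⊆ Q → LabelledChain P y z → LabelledChain Q y z
  LabelledChain-map P⊆Q (ws , ch , pws) = ws , ch , All.map P⊆Q pws

  Labelled-∷⇔ : ∀ {P y u us vs} → Labelled P u us ⇔ Labelled P u vs →
    Labelled P y (u ∷ us) ⇔ Labelled P y (u ∷ vs)
  Labelled-∷⇔ us⇔vs = mk⇔ (λ { (p ∷ ps) → p ∷ Equivalence.to us⇔vs ps })
                          (λ { (p ∷ ps) → p ∷ Equivalence.from us⇔vs ps })

  increasingChains-Labelled⇔ : ∀ {P y z vs ws} → IncreasingChain y z vs → IncreasingChain y z ws →
    Labelled P y vs ⇔ Labelled P y ws
  increasingChains-Labelled⇔ {P} {y} incr incr′ =
    subst (λ ws → Labelled P y _ ⇔ Labelled P y ws) (IncreasingChain-unique incr incr′) (⇔-id _)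

  module Interpolating (ip : IsInterpolating γ) where

    -- If the labels were equal, y ⋖ u ⋖ z would be the increasing chain of [y, z], which ip
    -- says has strictly increasing labels.
    consecutive-labels-distinct : ∀ {y u z} → y ⋖ u → u ⋖ z → γ y u ≢ γ u z
    consecutive-labels-distinct {y} {u} {z} y⋖u u⋖z γyu≡γuz with ip y u z y⋖u u⋖z
    ... | inj₁ γyu<γuz = ℤₚ.<-irrefl γyu≡γuz γyu<γuz
    ... | inj₂ (ws , ch , strict , _) =
      ℤₚ.<-irrefl γyu≡γuz (Linked.head (subst (StrictlyIncr ∘ labels γ y) ws≡yuz strict))
      where
      ws≡yuz : ws ≡ u ∷ z ∷ []
      ws≡yuz = IncreasingChain-unique (ch , Linked.map ℤₚ.<⇒≤ strict)
                                      ((y⋖u , u⋖z , refl) , ℤₚ.≤-reflexive γyu≡γuz ∷ [-])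

    increasing⇒strict : ∀ {y z} ws → IncreasingChain y z ws → StrictlyIncr (labels γ y ws)
    increasing⇒strict []           _ = []
    increasing⇒strict (_ ∷ [])     _ = [-]
    increasing⇒strict (u ∷ v ∷ ws) ((y⋖u , u⋖v , v⇝z) , γyu≤γuv ∷ incr) =
      ℤₚ.≤∧≢⇒< γyu≤γuv (consecutive-labels-distinct y⋖u u⋖v)
        ∷ increasing⇒strict (v ∷ ws) ((u⋖v , v⇝z) , incr)

    module _ {P : Pred ℤ 0ℓ} (convex : Convex P) where

      interpolation⇔ : ∀ {y u v} E vs → UChain y v E → WeaklyIncr (labels γ y E) →
        (∃[ l ] labels γ y E ≡ γ u v ∷ l) → (∃[ l ] labels γ y E ≡ l ∷ʳ γ y u) →
        Labelled P y (u ∷ v ∷ vs) ⇔ Labelled P y (E ++ vs)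
      interpolation⇔ {y} {u} {v} E vs y⇝v sorted first last = mk⇔ to from
        where
        ends = All-sorted⇔ends convex sorted first last
        labels≡ = labels-++ γ E vs y⇝v

        to : Labelled P y (u ∷ v ∷ vs) → Labelled P y (E ++ vs)
        to (pyu ∷ puv ∷ pvs) = subst (All P) (sym labels≡) (++⁺ (Equivalence.from ends (puv , pyu)) pvs)

        from : Labelled P y (E ++ vs) → Labelled P y (u ∷ v ∷ vs)
        from pEvs = let (pE , pvs) = ++⁻ (labels γ y E) (subst (All P) labels≡ pEvs)
                        (puv , pyu) = Equivalence.to ends pE
                    in pyu ∷ puv ∷ pvs

      Labelled⇔increasing : ∀ {y w ws is} → UChain y w ws → IncreasingChain y w is →
        Labelled P y ws ⇔ Labelled P y is
      Labelled⇔increasing {y} = outer y (po-noetherian po y)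
        where
        -- Induction downwards on y and, for fixed y, on the label of the first edge: a descent
        -- y ⋖ u ⋖ v at the start is replaced by the interpolating chain, whose labels lie between
        -- γ u v and γ y u (so convexity keeps All P in both directions) and whose first label is
        -- the smaller γ u v.
        outer : ∀ y → Acc (flip _<_) y → ∀ {w ws is} → UChain y w ws → IncreasingChain y w is →
          Labelled P y ws ⇔ Labelled P y is
        outer y _ {ws = []} refl incr = increasingChains-Labelled⇔ (refl , []) incr
        outer y (acc above) {w} {u ∷ ws} {is} (y⋖u , u⇝w) incr =
          let (us , incr-u) = increasingChain (UChain⇒≤ ws u⇝w)
          in begin
            Labelled P y (u ∷ ws) ≈⟨ Labelled-∷⇔ (outer u (above (proj₁ y⋖u)) u⇝w incr-u) ⟩
            Labelled P y (u ∷ us) ≈⟨ inner u (wf u) y⋖u incr-u ⟩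
            Labelled P y is       ∎
          where
          open SetoidReasoning (⇔-setoid 0ℓ)

          wf : WellFounded (ℤ._<_ on γ y)
          wf = spo-wellFounded (On.isStrictPartialOrder (γ y) ℤₚ.<-isStrictPartialOrder)

          inner : ∀ u → Acc (ℤ._<_ on γ y) u → ∀ {us} → y ⋖ u → IncreasingChain u w us →
            Labelled P y (u ∷ us) ⇔ Labelled P y is
          inner u _ {[]} y⋖u (refl , _) = increasingChains-Labelled⇔ ((y⋖u , refl) , [-]) incr
          inner u (acc smaller) {v ∷ vs} y⋖u ((u⋖v , v⇝w) , incr-u) with γ y u ℤₚ.≤? γ u v
          ... | yes γyu≤γuv = increasingChains-Labelled⇔ ((y⋖u , u⋖v , v⇝w) , γyu≤γuv ∷ incr-u) incr
          ... | no γyu≰γuv with ip y u v y⋖u u⋖v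
          ...   | inj₁ γyu<γuv = contradiction (ℤₚ.<⇒≤ γyu<γuv) γyu≰γuv
          ...   | inj₂ ([] , _ , _ , (_ , ()) , _)
          ...   | inj₂ (u′ ∷ E , (y⋖u′ , u′⇝v) , strict , first@(_ , labels≡) , last) =
            let (us′ , incr-u′) = increasingChain (UChain⇒≤ (E ++ vs) (UChain-++ E vs u′⇝v v⇝w))
                γyu′<γyu = subst (ℤ._< γ y u) (sym (∷-injectiveˡ labels≡)) (ℤₚ.≰⇒> γyu≰γuv)
            in begin
              Labelled P y (u ∷ v ∷ vs)   ≈⟨ interpolation⇔ (u′ ∷ E) vs (y⋖u′ , u′⇝v)
                                               (Linked.map ℤₚ.<⇒≤ strict) first last ⟩
              Labelled P y (u′ ∷ E ++ vs) ≈⟨ Labelled-∷⇔ (outer u′ (above (proj₁ y⋖u′))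
                                               (UChain-++ E vs u′⇝v v⇝w) incr-u′) ⟩
              Labelled P y (u′ ∷ us′)     ≈⟨ inner u′ (smaller γyu′<γyu) y⋖u′ incr-u′ ⟩
              Labelled P y is             ∎

      Labelled-agree : ∀ {y w ws vs} → UChain y w ws → UChain y w vs → Labelled P y ws → Labelled P y vs
      Labelled-agree {ws = ws} ch ch′ =
        let (is , incr) = increasingChain (UChain⇒≤ ws ch)
        in Equivalence.from (Labelled⇔increasing ch′ incr) ∘ Equivalence.to (Labelled⇔increasing ch incr)

      LabelledChain-increasing : ∀ {y z} → LabelledChain P y z →
        ∃ λ is → IncreasingChain y z is × Labelled P y is
      LabelledChain-increasing (ws , ch , pws) =
        let (is , incr) = increasingChain (UChain⇒≤ ws ch)
        in is , incr , Labelled-agree ch (proj₁ incr) pws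

      LabelledChain-split : ∀ {x y z} → LabelledChain P x z → x ≤ y → y ≤ z →
        LabelledChain P x y × LabelledChain P y z
      LabelledChain-split (ws , ch , pws) x≤y y≤z =
        let (us , x⇝y , _) = increasingChain x≤y
            (vs , y⇝z , _) = increasingChain y≤z
            (pus , pvs) = ++⁻ (labels γ _ us) (subst (All P) (labels-++ γ us vs x⇝y)
                                (Labelled-agree ch (UChain-++ us vs x⇝y y⇝z) pws))
        in (us , x⇝y , pus) , (vs , y⇝z , pvs)

    module Threshold (t : ℤ) where

      Below Above : Fin n → Fin n → Set
      Below = LabelledChain (ℤ._≤ t)
      Above = LabelledChain (t ℤ.<_)

      SplitsAt : Fin n → Fin n → Fin n → Set
      SplitsAt y z e = Below y e × Above e z

      Below-restrict : ∀ {y z u} → Below y z → y ≤ u → u ≤ z → Below y u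
      Below-restrict below y≤u u≤z = proj₁ (LabelledChain-split (≤-convex t) below y≤u u≤z)

      Above-restrict : ∀ {y z u} → Above y z → y ≤ u → u ≤ z → Above u z
      Above-restrict above y≤u u≤z = proj₂ (LabelledChain-split (<-convex t) above y≤u u≤z)

      increasing⇒split : ∀ {y z} ws → UChain y z ws → WeaklyIncr (labels γ y ws) → ∃ (SplitsAt y z)
      increasing⇒split {y} []       y≡z         _ = y , ([] , refl , []) , ([] , y≡z , [])
      increasing⇒split {y} (u ∷ ws) (y⋖u , u⇝z) incr with γ y u ℤₚ.≤? t
      ... | no γyu≰t =
        y , ([] , refl , []) ,
        (u ∷ ws , (y⋖u , u⇝z) ,
         All.map (ℤₚ.<-≤-trans (ℤₚ.≰⇒> γyu≰t)) (Linked⇒All ℤₚ.≤-trans ℤₚ.≤-refl incr))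
      ... | yes γyu≤t =
        let (e , below , above) = increasing⇒split ws u⇝z (Linked.tail incr)
        in e , LabelledChain-trans (u ∷ [] , (y⋖u , refl) , γyu≤t ∷ []) below , above

      split : ∀ {y z} → y ≤ z → ∃ (SplitsAt y z)
      split y≤z = let (ws , ch , incr) = increasingChain y≤z in increasing⇒split ws ch incr

      split-point-unique : ∀ {y e e′} as as′ {bs bs′} → UChain y e as → UChain y e′ as′ →
        as ++ bs ≡ as′ ++ bs′ →
        Labelled (ℤ._≤ t) y as → Labelled (t ℤ.<_) e bs →
        Labelled (ℤ._≤ t) y as′ → Labelled (t ℤ.<_) e′ bs′ → e ≡ e′
      split-point-unique [] [] refl refl _ _ _ _ _ = refl
      split-point-unique [] (_ ∷ _) refl _ refl _ (t<γ ∷ _) (γ≤t ∷ _) _ =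
        contradiction γ≤t (ℤₚ.<⇒≱ t<γ)
      split-point-unique (_ ∷ _) [] _ refl refl (γ≤t ∷ _) _ _ (t<γ ∷ _) =
        contradiction γ≤t (ℤₚ.<⇒≱ t<γ)
      split-point-unique (a ∷ as) (a′ ∷ as′) (_ , a⇝e) (_ , a′⇝e′) eq (_ ∷ pas) pbs (_ ∷ pas′) pbs′
        with refl ← ∷-injectiveˡ eq =
        split-point-unique as as′ a⇝e a′⇝e′ (∷-injectiveʳ eq) pas pbs pas′ pbs′

      SplitsAt⇒increasing : ∀ {y z e} → SplitsAt y z e →
        Σ[ as ∈ List (Fin n) ] Σ[ bs ∈ List (Fin n) ]
          IncreasingChain y z (as ++ bs) × UChain y e as × Labelled (ℤ._≤ t) y as × Labelled (t ℤ.<_) e bs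
      SplitsAt⇒increasing (below , above) =
        let (as , (y⇝e , incr-as) , pas) = LabelledChain-increasing (≤-convex t) below
            (bs , (e⇝z , incr-bs) , pbs) = LabelledChain-increasing (<-convex t) above
        in as , bs ,
           (UChain-++ as bs y⇝e e⇝z ,
            subst WeaklyIncr (sym (labels-++ γ as bs y⇝e)) (++-sorted t incr-as incr-bs pas pbs)) ,
           y⇝e , pas , pbs

      split-unique : ∀ {y z e e′} → SplitsAt y z e → SplitsAt y z e′ → e ≡ e′
      split-unique s s′ =
        let (as , bs , incr , y⇝e , pas , pbs) = SplitsAt⇒increasing s
            (as′ , bs′ , incr′ , y⇝e′ , pas′ , pbs′) = SplitsAt⇒increasing s′
        in split-point-unique as as′ y⇝e y⇝e′ (IncreasingChain-unique incr incr′) pas pbs pas′ pbs′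

      split-≤ : ∀ {y z e u} → SplitsAt y z e → y ≤ u → Above u z → e ≤ u
      split-≤ s y≤u above-u =
        let (e′ , below , above) = split y≤u
        in subst (_≤ _) (split-unique (below , LabelledChain-trans above above-u) s) (LabelledChain⇒≤ above)

      split-≥ : ∀ {y z e u} → SplitsAt y z e → Below y u → u ≤ z → u ≤ e
      split-≥ s below-u u≤z =
        let (e′ , below , above) = split u≤z
        in subst (_ ≤_) (split-unique (LabelledChain-trans below-u below , above) s) (LabelledChain⇒≤ below)

      module SplitPoint {bot top x} (bounded : IsBounded bot top) (sx : SplitsAt bot top x) where
        private
          bot≤ : ∀ u → bot ≤ u
          bot≤ = proj₁ ∘ bounded
          ≤top : ∀ u → u ≤ top
          ≤top = proj₂ ∘ bounded

        join : Fin n → Fin n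
        join y = proj₁ (split (≤top y))
        s-join : ∀ y → SplitsAt y top (join y)
        s-join y = proj₂ (split (≤top y))

        meet : Fin n → Fin n
        meet z = proj₁ (split (bot≤ z))
        s-meet : ∀ z → SplitsAt bot z (meet z)
        s-meet z = proj₂ (split (bot≤ z))

        isJoin : ∀ y → IsJoin x y (join y)
        isJoin y = split-≤ sx (bot≤ _) (proj₂ (s-join y)) , LabelledChain⇒≤ (proj₁ (s-join y)) ,
                   λ u x≤u y≤u → split-≤ (s-join y) y≤u (Above-restrict (proj₂ sx) x≤u (≤top u))

        isMeet : ∀ z → IsMeet x z (meet z)
        isMeet z = split-≥ sx (proj₁ (s-meet z)) (≤top _) , LabelledChain⇒≤ (proj₂ (s-meet z)) ,
                   λ u u≤x u≤z → split-≥ (s-meet z) (Below-restrict (proj₁ sx) (bot≤ u) u≤x) u≤z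

        module Interval {y z} (y≤z : y ≤ z) where
          e : Fin n
          e = proj₁ (split y≤z)
          s : SplitsAt y z e
          s = proj₂ (split y≤z)

          isRelMeet : IsRelMeet y (join y) z e
          isRelMeet = (LabelledChain⇒≤ (proj₁ s) , split-≥ (s-join y) (proj₁ s) (≤top e) ,
                       LabelledChain⇒≤ (proj₂ s)) ,
                      λ u y≤u u≤j u≤z → split-≥ s (Below-restrict (proj₁ (s-join y)) y≤u u≤j) u≤z

          isRelJoin : IsRelJoin z (meet z) y e
          isRelJoin = (split-≤ (s-meet z) (bot≤ e) (proj₂ s) , LabelledChain⇒≤ (proj₁ s) ,
                       LabelledChain⇒≤ (proj₂ s)) ,
                      λ u m≤u y≤u u≤z → split-≤ s y≤u (Above-restrict (proj₂ (s-meet z)) m≤u u≤z)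

        viable : Viable x
        viable y z y≤z = (join y , isJoin y , e , isRelMeet) , (meet z , isMeet z , e , isRelJoin)
          where open Interval y≤z

        leftModular : LeftModular x
        leftModular = viable , λ y z j m mt k y≤z j-join m-relMeet mt-meet k-relJoin →
          let open Interval y≤z
              j≡join = IsJoin-unique j-join (isJoin y)
              mt≡meet = IsMeet-unique mt-meet (isMeet z)
          in trans (IsRelMeet-unique (subst (λ j → IsRelMeet y j z m) j≡join m-relMeet) isRelMeet)
                   (IsRelJoin-unique isRelJoin (subst (λ mt → IsRelJoin z mt y k) mt≡meet k-relJoin))

    strictChain⇒LeftModular : ∀ {bot top} → IsBounded bot top → ∀ t {y} ws →
      Threshold.Below t bot y → UChain y top ws → Linked ℤ._<_ (t ∷ labels γ y ws) →
      All LeftModular (y ∷ ws)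
    strictChain⇒LeftModular bounded t [] below refl _ =
      Threshold.SplitPoint.leftModular t bounded (below , [] , refl , []) ∷ []
    strictChain⇒LeftModular bounded t {y} (u ∷ ws) below (y⋖u , u⇝top) (t<γyu ∷ sorted) =
      Threshold.SplitPoint.leftModular t bounded
        (below , u ∷ ws , (y⋖u , u⇝top) , Linked⇒All ℤₚ.<-trans t<γyu sorted)
      ∷ strictChain⇒LeftModular bounded (γ y u) ws
          (LabelledChain-trans (LabelledChain-map (λ a≤t → ℤₚ.≤-trans a≤t (ℤₚ.<⇒≤ t<γyu)) below)
                               (u ∷ [] , (y⋖u , refl) , ℤₚ.≤-refl ∷ []))
          u⇝top sorted

theorem3 : (n : ℕ) (_≤_ : Rel (Fin n) 0ℓ) → IsPartialOrder _≡_ _≤_ →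
    (bot top : Fin n) → Poset.IsBounded _≤_ bot top →
    (γ : Poset.EdgeLabelling _≤_) → Poset.IsEL _≤_ γ → Poset.IsInterpolating _≤_ γ →
    (ws : List (Fin n)) → Poset.UChain _≤_ bot top ws →
    Poset.WeaklyIncr _≤_ (Poset.labels _≤_ γ bot ws) →
    Poset.IsLeftModularMaximalChain _≤_ (bot ∷ ws)
theorem3 n _≤_ po bot top bounded γ el ip ws ch incr =
  let open ELLabelling po el
      open Interpolating ip
      (t , sorted) = strict-lowerBound (increasing⇒strict ws (ch , incr))
  in UnrefinableChains.UChain⇒maximal po bounded ws ch ,
     strictChain⇒LeftModular bounded t ws ([] , refl , []) ch sorted
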